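{- For every integer $n\ge1$ and every positive integer $r$, writing $W_m(k)=\sum_{j\ge0}\omega(k-jm)$: (a) $\displaystyle\sum_{k=1}^{n}(2^k-1)\,\omega(n-k)=\sum_{\substack{m+k=n\\ m\ge 1,\ k\ge 0}}\Phi(m)W_m(k)$; (b) $\displaystyle\sum_{k=1}^{n}\binom{k}{r}\omega(n-k)=\sum_{\substack{m+k=n\\ m\ge 1,\ k\ge 0}}\Phi_r(m)W_m(k)$.
   Context: $\Phi(m)$ is the number of nonempty subsets $S\subseteq\{1,\dots,m\}$ with $\gcd(\gcd(S),m)=1$, and $\Phi_r(m)$ is the number of such subsets of cardinality $r$. For integers $m$, $\omega(m)=1$ if $m=0$; $\omega(m)=(-1)^i$ if $m=\frac{3i^2\pm i}{2}$ for some positive integer $i$; $\omega(m)=0$ otherwise (in particular for $m<0$). -}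

module Defs where

open import Data.Nat as ℕ using (ℕ; zero; suc; _≤_; _≤?_)
open import Data.Nat.GCD using (gcd)
open import Data.Nat.Combinatorics using (_C_)
open import Data.Integer as ℤ using (ℤ; +_; -[1+_])
open import Data.Bool using (Bool; if_then_else_)
open import Data.List using (List; []; _∷_; _++_; map; filter; length; foldr)
open import Data.Vec using ([]; _∷_)
open import Data.Fin.Subset using (Subset; Side; inside; outside; ∣_∣)
open import Data.Product using (_×_)
open import Data.Sum using (_⊎_)
open import Relation.Nullary using (Dec; does)
open import Relation.Nullary.Decidable using (_×-dec_; _⊎-dec_)
open import Relation.Binary.PropositionalEquality using (_≡_)

sumBelow : ℕ → (ℕ → ℤ) → ℤ
sumBelow zero    f = + 0
sumBelow (suc n) f = sumBelow n f ℤ.+ f n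

-- Σ_{k=lo}^{hi} f k  (empty, i.e. 0, if hi < lo)
sumFromTo : ℕ → ℕ → (ℕ → ℤ) → ℤ
sumFromTo lo hi f = sumBelow (suc hi ℕ.∸ lo) (λ i → f (lo ℕ.+ i))

-- Subsets of {1,…,m}: a subset is a Subset m (Vec Side m), position i
-- (i = 0 … m-1) corresponds to the element i+1.

allSubsets : (m : ℕ) → List (Subset m)
allSubsets zero    = [] ∷ []
allSubsets (suc m) = map (inside ∷_) (allSubsets m) ++ map (outside ∷_) (allSubsets m)

elemsFrom : ∀ {m} → ℕ → Subset m → List ℕ
elemsFrom k []            = []
elemsFrom k (inside ∷ p)  = k ∷ elemsFrom (suc k) p
elemsFrom k (outside ∷ p) = elemsFrom (suc k) p

elems : ∀ {m} → Subset m → List ℕ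
elems = elemsFrom 1

-- gcd of a set of naturals (gcd ∅ = 0)
gcdSet : ∀ {m} → Subset m → ℕ
gcdSet S = foldr gcd 0 (elems S)

Good : (m : ℕ) → Subset m → Set
Good m S = (1 ≤ ∣ S ∣) × (gcd (gcdSet S) m ≡ 1)

good? : (m : ℕ) → (S : Subset m) → Dec (Good m S)
good? m S = (1 ≤? ∣ S ∣) ×-dec (gcd (gcdSet S) m ℕ.≟ 1)

Φ : ℕ → ℕ
Φ m = length (filter (good? m) (allSubsets m))

Φ[_] : ℕ → ℕ → ℕ
Φ[ r ] m = length (filter (λ S → good? m S ×-dec (∣ S ∣ ℕ.≟ r)) (allSubsets m))

Pent : ℕ → ℕ → Set
Pent m i = (2 ℕ.* m ≡ 3 ℕ.* i ℕ.* i ℕ.+ i) ⊎ (2 ℕ.* m ℕ.+ i ≡ 3 ℕ.* i ℕ.* i)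

pent? : ∀ m i → Dec (Pent m i)
pent? m i = (2 ℕ.* m ℕ.≟ 3 ℕ.* i ℕ.* i ℕ.+ i) ⊎-dec (2 ℕ.* m ℕ.+ i ℕ.≟ 3 ℕ.* i ℕ.* i)

sgn : ℕ → ℤ
sgn i = (ℤ.- + 1) ℤ.^ i

-- for m ≥ 1: the (unique, if any) positive i with m = (3i²±i)/2 satisfies
-- i ≤ m, and distinct (i, ±) give distinct pentagonal numbers, so summing
-- over i = 1 … m picks out exactly (-1)^i, or 0 if there is no such i.
ωℕ : ℕ → ℤ
ωℕ zero      = + 1
ωℕ m@(suc _) = sumFromTo 1 m (λ i → if does (pent? m i) then sgn i else + 0)

ω : ℤ → ℤ
ω (+ m)    = ωℕ m
ω -[1+ _ ] = + 0

-- W_m(k) = Σ_{j≥0} ω(k - j m).  For m ≥ 1 and k ≥ 0 all terms with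
-- j > k have k - j m < 0, hence vanish; so the sum is over j = 0 … k.
W : ℕ → ℕ → ℤ
W m k = sumFromTo 0 k (λ j → ω (+ k ℤ.- + (j ℕ.* m)))

{-# OPTIONS --safe #-}
module Submission where

-- Sorting the subsets S ⊆ {1,…,k} by d = gcd(gcd S, k) and dividing out d identifies
-- the class of d with the subsets S′ ⊆ {1,…,k/d} such that gcd(gcd S′, k/d) = 1.
-- Hence, for any condition Q on the size, #{S ⊆ [k] : Q |S|} = Σ_{dm = k} Ψ_Q(m),
-- where Ψ_Q(m) counts the coprime S′ ⊆ [m] with Q |S′|.  Substituting this into
-- Σ_k #{…} ω(n − k) and summing over d first gives Σ_m Ψ_Q(m) Σ_{d ≥ 1} ω(n − dm),
-- which is Σ_m Ψ_Q(m) W_m(n − m) because ω vanishes on negative arguments.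
-- Parts (a) and (b) are the cases "S nonempty" (2^k − 1 subsets) and "|S| = r".

open import Defs
open import Data.Nat as ℕ using (ℕ; zero; suc; _≤_; _<_; _∸_; _^_; _≟_; _≤?_; _≡ᵇ_; z≤n; s≤s; z<s; s<s)
import Data.Nat.Properties as ℕₚ
open import Data.Nat.Combinatorics using (_C_; nCk+nC[k+1]≡[n+1]C[k+1])
open import Data.Nat.Divisibility using (_∣_; _∣?_; divides; ∣-trans; n∣m*n; ∣m+n∣m⇒∣n; ∣⇒≤)
open import Data.Nat.GCD using (gcd; gcd[m,n]∣m; gcd[m,n]∣n; c*gcd[m,n]≡gcd[cm,cn]; gcd[m,n]≢0; gcd[m,n]≤n)
open import Data.Integer using (ℤ; +_; _+_; _-_; -_; _*_)
import Data.Integer.Properties as ℤₚ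
open import Algebra.Properties.CommutativeSemigroup ℤₚ.+-commutativeSemigroup using (interchange)
open import Data.Bool using (Bool; true; false; _∧_; if_then_else_)
open import Data.Bool.ListAction using (all)
open import Data.Bool.Properties using (∧-zeroʳ; ∧-comm; if-float; if-cong-else)
open import Data.List using (List; []; _∷_; _++_; map; filter; length; foldr)
open import Data.List.Properties using (length-map; length-++; filter-++)
open import Data.Vec using ([]; _∷_)
open import Data.Fin.Subset using (Subset; inside; outside; ∣_∣)
open import Data.Product using (_×_; _,_)
open import Data.Sum using (inj₂)
open import Function using (_∘_)
open import Function.Bundles using (mk⇔)
open import Relation.Nullary using (¬_; Dec; does; yes; no; contradiction)
open import Relation.Nullary.Decidable using (dec-true; dec-false; does-⇔)
open import Relation.Unary using (Decidable)
open import Relation.Binary.PropositionalEquality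
  using (_≡_; _≢_; refl; sym; trans; cong; cong₂; subst; module ≡-Reasoning)
open ≡-Reasoning

sumBelow-cong : ∀ n {f g : ℕ → ℤ} → (∀ i → i < n → f i ≡ g i) → sumBelow n f ≡ sumBelow n g
sumBelow-cong zero    f≗g = refl
sumBelow-cong (suc n) f≗g =
  cong₂ _+_ (sumBelow-cong n (λ i i<n → f≗g i (ℕₚ.m<n⇒m<1+n i<n))) (f≗g n ℕₚ.≤-refl)

sumBelow-zero : ∀ n {f : ℕ → ℤ} → (∀ i → i < n → f i ≡ + 0) → sumBelow n f ≡ + 0
sumBelow-zero zero    f≗0 = refl
sumBelow-zero (suc n) f≗0 =
  cong₂ _+_ (sumBelow-zero n (λ i i<n → f≗0 i (ℕₚ.m<n⇒m<1+n i<n))) (f≗0 n ℕₚ.≤-refl)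

sumBelow-distrib-+ : ∀ n (f g : ℕ → ℤ) →
  sumBelow n (λ i → f i + g i) ≡ sumBelow n f + sumBelow n g
sumBelow-distrib-+ zero    f g = refl
sumBelow-distrib-+ (suc n) f g =
  trans (cong (_+ (f n + g n)) (sumBelow-distrib-+ n f g)) (interchange (sumBelow n f) (sumBelow n g) (f n) (g n))

*-distribˡ-sumBelow : ∀ n x (f : ℕ → ℤ) → x * sumBelow n f ≡ sumBelow n (λ i → x * f i)
*-distribˡ-sumBelow zero    x f = ℤₚ.*-zeroʳ x
*-distribˡ-sumBelow (suc n) x f =
  trans (ℤₚ.*-distribˡ-+ x (sumBelow n f) (f n)) (cong (_+ x * f n) (*-distribˡ-sumBelow n x f))

*-distribʳ-sumBelow : ∀ n x (f : ℕ → ℤ) → sumBelow n f * x ≡ sumBelow n (λ i → f i * x)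
*-distribʳ-sumBelow zero    x f = ℤₚ.*-zeroˡ x
*-distribʳ-sumBelow (suc n) x f =
  trans (ℤₚ.*-distribʳ-+ x (sumBelow n f) (f n)) (cong (_+ f n * x) (*-distribʳ-sumBelow n x f))

sumBelow-comm : ∀ m n (F : ℕ → ℕ → ℤ) →
  sumBelow m (λ i → sumBelow n (F i)) ≡ sumBelow n (λ j → sumBelow m (λ i → F i j))
sumBelow-comm zero    n F = sym (sumBelow-zero n (λ _ _ → refl))
sumBelow-comm (suc m) n F =
  trans (cong (_+ sumBelow n (F m)) (sumBelow-comm m n F)) (sym (sumBelow-distrib-+ n _ (F m)))

sumBelow-truncate : ∀ {m n} {f : ℕ → ℤ} → m ≤ n → (∀ i → m ≤ i → i < n → f i ≡ + 0) →
  sumBelow n f ≡ sumBelow m f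
sumBelow-truncate {n = zero} z≤n _ = refl
sumBelow-truncate {m} {suc n} {f} m≤1+n zeros with m ℕ.≤? n
... | yes m≤n = trans (cong₂ _+_ (sumBelow-truncate m≤n (λ i m≤i i<n → zeros i m≤i (ℕₚ.m<n⇒m<1+n i<n)))
                                 (zeros n m≤n ℕₚ.≤-refl))
                      (ℤₚ.+-identityʳ (sumBelow m f))
... | no m≰n  = cong (λ k → sumBelow k f) (ℕₚ.≤-antisym (ℕₚ.≰⇒> m≰n) m≤1+n)

sumBelow-single : ∀ n c {f : ℕ → ℤ} → c < n → (∀ i → i < n → i ≢ c → f i ≡ + 0) →
  sumBelow n f ≡ f c
sumBelow-single n c {f} c<n others = begin
  sumBelow n f         ≡⟨ sumBelow-truncate c<n (λ i c<i i<n → others i i<n (ℕₚ.>⇒≢ c<i)) ⟩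
  sumBelow c f + f c   ≡⟨ cong (_+ f c) (sumBelow-zero c (λ i i<c → others i (ℕₚ.<-trans i<c c<n) (ℕₚ.<⇒≢ i<c))) ⟩
  + 0 + f c            ≡⟨ ℤₚ.+-identityˡ (f c) ⟩
  f c                  ∎

sumBelow-indicator : ∀ n c (g : ℕ → ℤ) → (n ≤ c → g c ≡ + 0) →
  sumBelow n (λ k → if c ≡ᵇ k then g k else + 0) ≡ g c
sumBelow-indicator n c g vanishes with c ℕₚ.<? n
... | yes c<n = trans (sumBelow-single n c c<n (λ k _ k≢c → cong (λ b → if b then g k else + 0)
                                                                  (dec-false (c ≟ k) (k≢c ∘ sym))))
                      (cong (λ b → if b then g c else + 0) (dec-true (c ≟ c) refl))
... | no c≮n  = trans (sumBelow-zero n (λ k k<n → cong (λ b → if b then g k else + 0)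
                                                       (dec-false (c ≟ k) (λ { refl → c≮n k<n }))))
                      (sym (vanishes (ℕₚ.≮⇒≥ c≮n)))

-- countSubsets m s F is the number of subsets of {s, …, s + m − 1} whose increasing
-- list of elements satisfies F.
countSubsets : ℕ → ℕ → (List ℕ → Bool) → ℕ
countSubsets zero    s F = if F [] then 1 else 0
countSubsets (suc m) s F = countSubsets m (suc s) (λ l → F (s ∷ l)) ℕ.+ countSubsets m (suc s) F

countSubsets-cong : ∀ m s {F G : List ℕ → Bool} → (∀ l → F l ≡ G l) →
  countSubsets m s F ≡ countSubsets m s G
countSubsets-cong zero    s F≗G = cong (λ b → if b then 1 else 0) (F≗G [])
countSubsets-cong (suc m) s F≗G =
  cong₂ ℕ._+_ (countSubsets-cong m (suc s) (λ l → F≗G (s ∷ l))) (countSubsets-cong m (suc s) F≗G)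

countSubsets-none : ∀ m s {F : List ℕ → Bool} → (∀ l → F l ≡ false) → countSubsets m s F ≡ 0
countSubsets-none zero    s F≗false = cong (λ b → if b then 1 else 0) (F≗false [])
countSubsets-none (suc m) s F≗false =
  cong₂ ℕ._+_ (countSubsets-none m (suc s) (λ l → F≗false (s ∷ l))) (countSubsets-none m (suc s) F≗false)

countSubsets-all : ∀ m s → countSubsets m s (λ _ → true) ≡ 2 ^ m
countSubsets-all zero    s = refl
countSubsets-all (suc m) s =
  cong₂ ℕ._+_ (countSubsets-all m (suc s)) (trans (countSubsets-all m (suc s)) (sym (ℕₚ.+-identityʳ _)))

countSubsets-nonempty : ∀ m s → countSubsets m s (λ l → does (1 ≤? length l)) ≡ 2 ^ m ∸ 1
countSubsets-nonempty zero    s = refl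
countSubsets-nonempty (suc m) s = begin
  countSubsets m (suc s) (λ _ → true) ℕ.+ countSubsets m (suc s) (λ l → does (1 ≤? length l))
    ≡⟨ cong₂ ℕ._+_ (countSubsets-all m (suc s)) (countSubsets-nonempty m (suc s)) ⟩
  2 ^ m ℕ.+ (2 ^ m ∸ 1)
    ≡⟨ ℕₚ.+-∸-assoc (2 ^ m) (ℕₚ.m^n>0 2 m) ⟨
  (2 ^ m ℕ.+ 2 ^ m) ∸ 1
    ≡⟨ cong (λ x → (2 ^ m ℕ.+ x) ∸ 1) (ℕₚ.+-identityʳ (2 ^ m)) ⟨
  2 ^ suc m ∸ 1
    ∎

countSubsets-size : ∀ m s r → countSubsets m s (λ l → does (length l ≟ r)) ≡ m C r
countSubsets-size zero    s zero    = refl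
countSubsets-size zero    s (suc r) = refl
countSubsets-size (suc m) s zero    =
  cong₂ ℕ._+_ (countSubsets-none m (suc s) (λ _ → refl)) (countSubsets-size m (suc s) zero)
countSubsets-size (suc m) s (suc r) =
  trans (cong₂ ℕ._+_ (countSubsets-size m (suc s) r) (countSubsets-size m (suc s) (suc r)))
        (nCk+nC[k+1]≡[n+1]C[k+1] m r)

countSubsets-skip : ∀ j m s {F : List ℕ → Bool} → (∀ i l → i < j → F (i ℕ.+ s ∷ l) ≡ false) →
  countSubsets (j ℕ.+ m) s F ≡ countSubsets m (j ℕ.+ s) F
countSubsets-skip zero    m s excluded = refl
countSubsets-skip (suc j) m s {F} excluded = begin
  countSubsets (j ℕ.+ m) (suc s) (λ l → F (s ∷ l)) ℕ.+ countSubsets (j ℕ.+ m) (suc s) F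
    ≡⟨ cong (ℕ._+ countSubsets (j ℕ.+ m) (suc s) F)
            (countSubsets-none (j ℕ.+ m) (suc s) (λ l → excluded 0 l z<s)) ⟩
  countSubsets (j ℕ.+ m) (suc s) F
    ≡⟨ countSubsets-skip j m (suc s) (λ i l i<j →
         trans (cong (λ x → F (x ∷ l)) (ℕₚ.+-suc i s)) (excluded (suc i) l (s<s i<j))) ⟩
  countSubsets m (j ℕ.+ suc s) F
    ≡⟨ cong (λ x → countSubsets m x F) (ℕₚ.+-suc j s) ⟩
  countSubsets m (suc j ℕ.+ s) F
    ∎

countSubsets-partition : ∀ n m s (F : List ℕ → Bool) (κ : List ℕ → ℕ) →
  (∀ l → 1 ≤ κ l) → (∀ l → κ l ≤ n) →
  + countSubsets m s F ≡ sumBelow n (λ i → + countSubsets m s (λ l → F l ∧ does (κ l ≟ suc i)))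
countSubsets-partition n zero s F κ κ≥1 κ≤n with F [] | κ [] | κ≥1 [] | κ≤n []
... | false | _     | _ | _   = sym (sumBelow-zero n (λ _ _ → refl))
... | true  | suc c | _ | c<n = sym (begin
  sumBelow n (λ i → + (if c ≡ᵇ i then 1 else 0))
    ≡⟨ sumBelow-cong n (λ i _ → if-float +_ (c ≡ᵇ i)) ⟩
  sumBelow n (λ i → if c ≡ᵇ i then + 1 else + 0)
    ≡⟨ sumBelow-indicator n c (λ _ → + 1) (λ n≤c → contradiction c<n (ℕₚ.≤⇒≯ n≤c)) ⟩
  + 1
    ∎)
countSubsets-partition n (suc m) s F κ κ≥1 κ≤n = begin
  + (countSubsets m (suc s) (F ∘ (s ∷_)) ℕ.+ countSubsets m (suc s) F)
    ≡⟨ ℤₚ.pos-+ (countSubsets m (suc s) (F ∘ (s ∷_))) (countSubsets m (suc s) F) ⟩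
  + countSubsets m (suc s) (F ∘ (s ∷_)) + + countSubsets m (suc s) F
    ≡⟨ cong₂ _+_ (countSubsets-partition n m (suc s) (F ∘ (s ∷_)) (κ ∘ (s ∷_)) (κ≥1 ∘ (s ∷_)) (κ≤n ∘ (s ∷_)))
                 (countSubsets-partition n m (suc s) F κ κ≥1 κ≤n) ⟩
  sumBelow n (λ i → + withS i) + sumBelow n (λ i → + withoutS i)
    ≡⟨ sumBelow-distrib-+ n (λ i → + withS i) (λ i → + withoutS i) ⟨
  sumBelow n (λ i → + withS i + + withoutS i)
    ≡⟨ sumBelow-cong n (λ i _ → sym (ℤₚ.pos-+ (withS i) (withoutS i))) ⟩
  sumBelow n (λ i → + (withS i ℕ.+ withoutS i))
    ∎
  where
  withS withoutS : ℕ → ℕ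
  withS    i = countSubsets m (suc s) (λ l → F (s ∷ l) ∧ does (κ (s ∷ l) ≟ suc i))
  withoutS i = countSubsets m (suc s) (λ l → F l ∧ does (κ l ≟ suc i))

length-filter-map : ∀ {A B : Set} {P : B → Set} (P? : Decidable P) (f : A → B) xs →
  length (filter P? (map f xs)) ≡ length (filter (P? ∘ f) xs)
length-filter-map P? f []       = refl
length-filter-map P? f (x ∷ xs) with does (P? (f x))
... | true  = cong suc (length-filter-map P? f xs)
... | false = length-filter-map P? f xs

length-filter-allSubsets : ∀ m s {P : Subset m → Set} (P? : Decidable P) (F : List ℕ → Bool) →
  (∀ S → does (P? S) ≡ F (elemsFrom s S)) → length (filter P? (allSubsets m)) ≡ countSubsets m s F
length-filter-allSubsets zero s P? F P≗F with does (P? []) | P≗F []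
... | true  | eq = cong (λ b → if b then 1 else 0) eq
... | false | eq = cong (λ b → if b then 1 else 0) eq
length-filter-allSubsets (suc m) s P? F P≗F = begin
  length (filter P? (withS ++ withoutS))
    ≡⟨ cong length (filter-++ P? withS withoutS) ⟩
  length (filter P? withS ++ filter P? withoutS)
    ≡⟨ length-++ (filter P? withS) ⟩
  length (filter P? withS) ℕ.+ length (filter P? withoutS)
    ≡⟨ cong₂ ℕ._+_ (trans (length-filter-map P? (inside ∷_) (allSubsets m))
                          (length-filter-allSubsets m (suc s) _ _ (P≗F ∘ (inside ∷_))))
                   (trans (length-filter-map P? (outside ∷_) (allSubsets m))
                          (length-filter-allSubsets m (suc s) _ _ (P≗F ∘ (outside ∷_)))) ⟩
  countSubsets (suc m) s F
    ∎
  where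
  withS withoutS : List (Subset (suc m))
  withS    = map (inside ∷_) (allSubsets m)
  withoutS = map (outside ∷_) (allSubsets m)

∣∣≡length-elemsFrom : ∀ {m} s (S : Subset m) → ∣ S ∣ ≡ length (elemsFrom s S)
∣∣≡length-elemsFrom s []            = refl
∣∣≡length-elemsFrom s (inside ∷ S)  = cong suc (∣∣≡length-elemsFrom (suc s) S)
∣∣≡length-elemsFrom s (outside ∷ S) = ∣∣≡length-elemsFrom (suc s) S

gcdList : List ℕ → ℕ
gcdList = foldr gcd 0

countCoprime : (ℕ → Bool) → ℕ → ℕ
countCoprime Q m = countSubsets m 1 (λ l → Q (length l) ∧ does (gcd (gcdList l) m ≟ 1))

Φ≡countCoprime : ∀ m → Φ m ≡ countCoprime (λ x → does (1 ≤? x)) m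
Φ≡countCoprime m = length-filter-allSubsets m 1 (good? m) _ (λ S →
  cong (λ x → does (1 ≤? x) ∧ does (gcd (gcdSet S) m ≟ 1)) (∣∣≡length-elemsFrom 1 S))

Φ[r]≡countCoprime : ∀ r m → 1 ≤ r → Φ[ r ] m ≡ countCoprime (λ x → does (x ≟ r)) m
Φ[r]≡countCoprime (suc r) m _ = length-filter-allSubsets m 1 _ _ (λ S →
  trans (cong (λ x → (does (1 ≤? x) ∧ does (gcd (gcdSet S) m ≟ 1)) ∧ does (x ≟ suc r))
              (∣∣≡length-elemsFrom 1 S))
        (sizeFirst (length (elems S)) (does (gcd (gcdSet S) m ≟ 1))))
  where
  sizeFirst : ∀ x b → (does (1 ≤? x) ∧ b) ∧ does (x ≟ suc r) ≡ does (x ≟ suc r) ∧ b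
  sizeFirst zero    b = refl
  sizeFirst (suc x) b = ∧-comm b (does (x ≟ r))

gcd[m,n]*c≡gcd[mc,nc] : ∀ m n c → gcd m n ℕ.* c ≡ gcd (m ℕ.* c) (n ℕ.* c)
gcd[m,n]*c≡gcd[mc,nc] m n c = begin
  gcd m n ℕ.* c               ≡⟨ ℕₚ.*-comm (gcd m n) c ⟩
  c ℕ.* gcd m n               ≡⟨ c*gcd[m,n]≡gcd[cm,cn] c m n ⟩
  gcd (c ℕ.* m) (c ℕ.* n)     ≡⟨ cong₂ gcd (ℕₚ.*-comm c m) (ℕₚ.*-comm c n) ⟩
  gcd (m ℕ.* c) (n ℕ.* c)     ∎

gcdList-map-* : ∀ c l → gcdList (map (ℕ._* c) l) ≡ gcdList l ℕ.* c
gcdList-map-* c []      = refl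
gcdList-map-* c (x ∷ l) =
  trans (cong (gcd (x ℕ.* c)) (gcdList-map-* c l)) (sym (gcd[m,n]*c≡gcd[mc,nc] x (gcdList l) c))

∣gcdList⇒all∣ : ∀ g l → g ∣ gcdList l → all (λ x → does (g ∣? x)) l ≡ true
∣gcdList⇒all∣ g []      _       = refl
∣gcdList⇒all∣ g (x ∷ l) g∣gcd =
  cong₂ _∧_ (dec-true (g ∣? x) (∣-trans g∣gcd (gcd[m,n]∣m x (gcdList l))))
            (∣gcdList⇒all∣ g l (∣-trans g∣gcd (gcd[m,n]∣n x (gcdList l))))

-- Of {t g + 1, …, (t + q) g} only the multiples (t + 1) g, …, (t + q) g of g = suc h may
-- occur; skipping the h non-multiples before each one and dividing by g leaves the
-- subsets of {t + 1, …, t + q}.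
countSubsets-multiples : ∀ h q t (F : List ℕ → Bool) →
  countSubsets (q ℕ.* suc h) (suc (t ℕ.* suc h)) (λ l → all (λ x → does (suc h ∣? x)) l ∧ F l)
  ≡ countSubsets q (suc t) (λ l → F (map (ℕ._* suc h) l))
countSubsets-multiples h zero    t F = refl
countSubsets-multiples h (suc q) t F = begin
  countSubsets (suc q ℕ.* g) (suc (t ℕ.* g)) G
    ≡⟨ cong (λ m → countSubsets m (suc (t ℕ.* g)) G) (ℕₚ.+-suc h (q ℕ.* g)) ⟨
  countSubsets (h ℕ.+ suc (q ℕ.* g)) (suc (t ℕ.* g)) G
    ≡⟨ countSubsets-skip h (suc (q ℕ.* g)) (suc (t ℕ.* g)) nonMultiple ⟩
  countSubsets (suc (q ℕ.* g)) (h ℕ.+ suc (t ℕ.* g)) G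
    ≡⟨ cong (λ s → countSubsets (suc (q ℕ.* g)) s G) (ℕₚ.+-suc h (t ℕ.* g)) ⟩
  countSubsets (suc (q ℕ.* g)) (suc t ℕ.* g) G
    ≡⟨ cong₂ ℕ._+_ (trans (countSubsets-cong (q ℕ.* g) (suc (suc t ℕ.* g)) multipleFirst)
                          (countSubsets-multiples h q (suc t) (λ l → F (suc t ℕ.* g ∷ l))))
                   (countSubsets-multiples h q (suc t) F) ⟩
  countSubsets (suc q) (suc t) (λ l → F (map (ℕ._* g) l))
    ∎
  where
  g : ℕ
  g = suc h
  divisible : ℕ → Bool
  divisible x = does (g ∣? x)
  G : List ℕ → Bool
  G l = all divisible l ∧ F l
  multipleFirst : ∀ l → G (suc t ℕ.* g ∷ l) ≡ all divisible l ∧ F (suc t ℕ.* g ∷ l)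
  multipleFirst l = cong (λ b → (b ∧ all divisible l) ∧ F (suc t ℕ.* g ∷ l))
                         (dec-true (g ∣? suc t ℕ.* g) (n∣m*n (suc t)))
  g∤ : ∀ i → i < h → ¬ g ∣ i ℕ.+ suc (t ℕ.* g)
  g∤ i i<h g∣ = ℕₚ.<⇒≱ (s≤s i<h) (∣⇒≤ (∣m+n∣m⇒∣n g∣tg+1+i (n∣m*n t)))
    where
    g∣tg+1+i : g ∣ t ℕ.* g ℕ.+ suc i
    g∣tg+1+i = subst (g ∣_) (trans (ℕₚ.+-suc i (t ℕ.* g)) (ℕₚ.+-comm (suc i) (t ℕ.* g))) g∣
  nonMultiple : ∀ i l → i < h → G (i ℕ.+ suc (t ℕ.* g) ∷ l) ≡ false
  nonMultiple i l i<h = cong (λ b → (b ∧ all divisible l) ∧ F (i ℕ.+ suc (t ℕ.* g) ∷ l))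
                             (dec-false (g ∣? i ℕ.+ suc (t ℕ.* g)) (g∤ i i<h))

countSubsets-gcd≡countCoprime : ∀ h q (Q : ℕ → Bool) →
  countSubsets (q ℕ.* suc h) 1 (λ l → Q (length l) ∧ does (gcd (gcdList l) (q ℕ.* suc h) ≟ suc h))
  ≡ countCoprime Q q
countSubsets-gcd≡countCoprime h q Q = begin
  countSubsets (q ℕ.* g) 1 P
    ≡⟨ countSubsets-cong (q ℕ.* g) 1 onlyMultiples ⟩
  countSubsets (q ℕ.* g) 1 (λ l → all (λ x → does (g ∣? x)) l ∧ P l)
    ≡⟨ countSubsets-multiples h q 0 P ⟩
  countSubsets q 1 (λ l → P (map (ℕ._* g) l))
    ≡⟨ countSubsets-cong q 1 (λ l → cong₂ _∧_ (cong Q (length-map (ℕ._* g) l)) (gcd≡g⇔coprime l)) ⟩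
  countCoprime Q q
    ∎
  where
  g : ℕ
  g = suc h
  P : List ℕ → Bool
  P l = Q (length l) ∧ does (gcd (gcdList l) (q ℕ.* g) ≟ g)
  onlyMultiples : ∀ l → P l ≡ all (λ x → does (g ∣? x)) l ∧ P l
  onlyMultiples l = absorb (gcd (gcdList l) (q ℕ.* g) ≟ g)
    where
    absorb : (d : Dec (gcd (gcdList l) (q ℕ.* g) ≡ g)) →
             Q (length l) ∧ does d ≡ all (λ x → does (g ∣? x)) l ∧ (Q (length l) ∧ does d)
    absorb (yes gcd≡g) = sym (cong (_∧ (Q (length l) ∧ true))
                                   (∣gcdList⇒all∣ g l (subst (_∣ gcdList l) gcd≡g (gcd[m,n]∣m _ _))))
    absorb (no _) = trans (∧-zeroʳ (Q (length l)))
                          (sym (trans (cong (all (λ x → does (g ∣? x)) l ∧_) (∧-zeroʳ (Q (length l))))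
                                      (∧-zeroʳ (all (λ x → does (g ∣? x)) l))))
  gcd≡g⇔coprime : ∀ l → does (gcd (gcdList (map (ℕ._* g) l)) (q ℕ.* g) ≟ g) ≡ does (gcd (gcdList l) q ≟ 1)
  gcd≡g⇔coprime l = begin
    does (gcd (gcdList (map (ℕ._* g) l)) (q ℕ.* g) ≟ g)
      ≡⟨ cong (λ x → does (gcd x (q ℕ.* g) ≟ g)) (gcdList-map-* g l) ⟩
    does (gcd (gcdList l ℕ.* g) (q ℕ.* g) ≟ g)
      ≡⟨ cong (λ x → does (x ≟ g)) (gcd[m,n]*c≡gcd[mc,nc] (gcdList l) q g) ⟨
    does (gcd (gcdList l) q ℕ.* g ≟ g)
      ≡⟨ does-⇔ (mk⇔ (λ e → ℕₚ.*-cancelʳ-≡ (gcd (gcdList l) q) 1 g (trans e (sym (ℕₚ.*-identityˡ g))))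
                     (λ e → trans (cong (ℕ._* g) e) (ℕₚ.*-identityˡ g)))
                (gcd (gcdList l) q ℕ.* g ≟ g) (gcd (gcdList l) q ≟ 1) ⟩
    does (gcd (gcdList l) q ≟ 1)
      ∎

countSubsets-gcdClass : ∀ n k h (Q : ℕ → Bool) → suc k ≤ n →
  + countSubsets (suc k) 1 (λ l → Q (length l) ∧ does (gcd (gcdList l) (suc k) ≟ suc h))
  ≡ sumBelow n (λ m → if suc h ℕ.* suc m ≡ᵇ suc k then + countCoprime Q (suc m) else + 0)
countSubsets-gcdClass n k h Q k<n with suc h ∣? suc k
... | yes (divides (suc q) refl) = begin
  + countSubsets (suc q ℕ.* g) 1 (λ l → Q (length l) ∧ does (gcd (gcdList l) (suc q ℕ.* g) ≟ g))
    ≡⟨ cong +_ (countSubsets-gcd≡countCoprime h (suc q) Q) ⟩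
  + countCoprime Q (suc q)
    ≡⟨ cong (λ b → if b then + countCoprime Q (suc q) else + 0)
            (dec-true (g ℕ.* suc q ≟ suc q ℕ.* g) (ℕₚ.*-comm g (suc q))) ⟨
  term q
    ≡⟨ sumBelow-single n q (ℕₚ.≤-trans (ℕₚ.m≤m*n (suc q) g) k<n) others ⟨
  sumBelow n term
    ∎
  where
  g : ℕ
  g = suc h
  term : ℕ → ℤ
  term m = if g ℕ.* suc m ≡ᵇ suc q ℕ.* g then + countCoprime Q (suc m) else + 0
  others : ∀ m → m < n → m ≢ q → term m ≡ + 0
  others m _ m≢q = cong (λ b → if b then + countCoprime Q (suc m) else + 0)
    (dec-false (g ℕ.* suc m ≟ suc q ℕ.* g)
      (λ e → m≢q (ℕₚ.suc-injective (ℕₚ.*-cancelˡ-≡ (suc m) (suc q) g (trans e (ℕₚ.*-comm (suc q) g))))))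
... | no g∤k = trans (cong +_ (countSubsets-none (suc k) 1 emptyClass)) (sym (sumBelow-zero n noCofactor))
  where
  emptyClass : ∀ l → Q (length l) ∧ does (gcd (gcdList l) (suc k) ≟ suc h) ≡ false
  emptyClass l = trans (cong (Q (length l) ∧_) (dec-false (gcd (gcdList l) (suc k) ≟ suc h)
                         (λ gcd≡g → g∤k (subst (_∣ suc k) gcd≡g (gcd[m,n]∣n (gcdList l) (suc k))))))
                       (∧-zeroʳ (Q (length l)))
  noCofactor : ∀ m → m < n → (if suc h ℕ.* suc m ≡ᵇ suc k then + countCoprime Q (suc m) else + 0) ≡ + 0
  noCofactor m _ = cong (λ b → if b then + countCoprime Q (suc m) else + 0)
    (dec-false (suc h ℕ.* suc m ≟ suc k) (λ e → g∤k (divides (suc m) (trans (sym e) (ℕₚ.*-comm (suc h) (suc m))))))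

divisorSum : ℕ → (ℕ → ℤ) → ℕ → ℤ
divisorSum n f k = sumBelow n (λ d → sumBelow n (λ m → if suc d ℕ.* suc m ≡ᵇ k then f (suc m) else + 0))

countSubsets≡divisorSum : ∀ n k (Q : ℕ → Bool) → 1 ≤ k → k ≤ n →
  + countSubsets k 1 (λ l → Q (length l)) ≡ divisorSum n (λ m → + countCoprime Q m) k
countSubsets≡divisorSum n (suc k) Q _ k<n =
  trans (countSubsets-partition n (suc k) 1 (λ l → Q (length l)) (λ l → gcd (gcdList l) (suc k))
                                (λ l → ℕₚ.n≢0⇒n>0 (gcd[m,n]≢0 (gcdList l) (suc k) (inj₂ (λ ()))))
                                (λ l → ℕₚ.≤-trans (gcd[m,n]≤n (gcdList l) (suc k)) k<n))
        (sumBelow-cong n (λ d _ → countSubsets-gcdClass n k d Q k<n))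

n<x⇒ω[n-x]≡0 : ∀ n x → n < x → ω (+ n - + x) ≡ + 0
n<x⇒ω[n-x]≡0 n x n<x = trans (cong ω (trans (ℤₚ.m-n≡m⊖n n x) (ℤₚ.⊖-< n<x)))
                    (ω-neg (x ∸ n) (ℕₚ.m<n⇒0<n∸m n<x))
  where
  ω-neg : ∀ y → 0 < y → ω (- + y) ≡ + 0
  ω-neg (suc y) _ = refl

n-[a+b]≡[n∸a]-b : ∀ n a b → a ≤ n → + n - + (a ℕ.+ b) ≡ + (n ∸ a) - + b
n-[a+b]≡[n∸a]-b n a b a≤n = begin
  + n - + (a ℕ.+ b)        ≡⟨ cong (λ x → + n - x) (ℤₚ.pos-+ a b) ⟩
  + n + - (+ a + + b)      ≡⟨ cong (_+_ (+ n)) (ℤₚ.neg-distrib-+ (+ a) (+ b)) ⟩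
  + n + (- + a + - + b)    ≡⟨ ℤₚ.+-assoc (+ n) (- + a) (- + b) ⟨
  + n - + a - + b          ≡⟨ cong (_- + b) (trans (ℤₚ.m-n≡m⊖n n a) (ℤₚ.⊖-≥ a≤n)) ⟩
  + (n ∸ a) - + b          ∎

sumBelow-ω-multiples : ∀ n m → suc m ≤ n →
  sumBelow n (λ d → ω (+ n - + (suc d ℕ.* suc m))) ≡ W (suc m) (n ∸ suc m)
sumBelow-ω-multiples n m m<n = begin
  sumBelow n (λ d → ω (+ n - + (suc d ℕ.* suc m)))
    ≡⟨ sumBelow-truncate (ℕₚ.∸-monoʳ-< z<s m<n) beyond ⟩
  sumBelow (suc (n ∸ suc m)) (λ d → ω (+ n - + (suc m ℕ.+ d ℕ.* suc m)))
    ≡⟨ sumBelow-cong (suc (n ∸ suc m)) (λ d _ → cong ω (n-[a+b]≡[n∸a]-b n (suc m) (d ℕ.* suc m) m<n)) ⟩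
  W (suc m) (n ∸ suc m)
    ∎
  where
  beyond : ∀ d → suc (n ∸ suc m) ≤ d → d < n → ω (+ n - + (suc d ℕ.* suc m)) ≡ + 0
  beyond d n-m≤d _ = n<x⇒ω[n-x]≡0 n (suc d ℕ.* suc m)
    (subst (_< suc m ℕ.+ d ℕ.* suc m) (ℕₚ.m+[n∸m]≡n m<n)
           (ℕₚ.<-≤-trans (ℕₚ.+-monoʳ-< (suc m) n-m≤d) (ℕₚ.+-monoʳ-≤ (suc m) (ℕₚ.m≤m*n d (suc m)))))

sumBelow-divisorSum-ω : ∀ n (f : ℕ → ℤ) →
  sumBelow n (λ k → divisorSum n f (suc k) * ω (+ n - + suc k))
  ≡ sumBelow n (λ m → f (suc m) * W (suc m) (n ∸ suc m))
sumBelow-divisorSum-ω n f = begin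
  sumBelow n (λ k → divisorSum n f (suc k) * h (suc k))
    ≡⟨ sumBelow-cong n (λ k _ → distribute k) ⟩
  sumBelow n (λ k → sumBelow n (λ d → sumBelow n (λ m → term k d m)))
    ≡⟨ sumBelow-comm n n (λ k d → sumBelow n (λ m → term k d m)) ⟩
  sumBelow n (λ d → sumBelow n (λ k → sumBelow n (λ m → term k d m)))
    ≡⟨ sumBelow-cong n (λ d _ → sumBelow-comm n n (λ k m → term k d m)) ⟩
  sumBelow n (λ d → sumBelow n (λ m → sumBelow n (λ k → term k d m)))
    ≡⟨ sumBelow-cong n (λ d _ → sumBelow-cong n (λ m _ → collapse d m)) ⟩
  sumBelow n (λ d → sumBelow n (λ m → f (suc m) * h (suc d ℕ.* suc m)))
    ≡⟨ sumBelow-comm n n (λ d m → f (suc m) * h (suc d ℕ.* suc m)) ⟩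
  sumBelow n (λ m → sumBelow n (λ d → f (suc m) * h (suc d ℕ.* suc m)))
    ≡⟨ sumBelow-cong n (λ m m<n → trans (sym (*-distribˡ-sumBelow n (f (suc m)) (λ d → h (suc d ℕ.* suc m))))
                                        (cong (f (suc m) *_) (sumBelow-ω-multiples n m m<n))) ⟩
  sumBelow n (λ m → f (suc m) * W (suc m) (n ∸ suc m))
    ∎
  where
  h : ℕ → ℤ
  h k = ω (+ n - + k)
  term : ℕ → ℕ → ℕ → ℤ
  term k d m = if suc d ℕ.* suc m ≡ᵇ suc k then f (suc m) * h (suc k) else + 0
  if-*ʳ : ∀ b x y → (if b then x else + 0) * y ≡ (if b then x * y else + 0)
  if-*ʳ b x y = trans (if-float (_* y) b) (if-cong-else b (ℤₚ.*-zeroˡ y))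
  distribute : ∀ k → divisorSum n f (suc k) * h (suc k) ≡ sumBelow n (λ d → sumBelow n (λ m → term k d m))
  distribute k = trans (*-distribʳ-sumBelow n (h (suc k)) _) (sumBelow-cong n (λ d _ →
                 trans (*-distribʳ-sumBelow n (h (suc k)) _) (sumBelow-cong n (λ m _ →
                 if-*ʳ (suc d ℕ.* suc m ≡ᵇ suc k) (f (suc m)) (h (suc k))))))
  collapse : ∀ d m → sumBelow n (λ k → term k d m) ≡ f (suc m) * h (suc d ℕ.* suc m)
  collapse d m = sumBelow-indicator n (m ℕ.+ d ℕ.* suc m) (λ k → f (suc m) * h (suc k)) (λ n≤dm →
    trans (cong (f (suc m) *_) (n<x⇒ω[n-x]≡0 n (suc d ℕ.* suc m) (s≤s n≤dm))) (ℤₚ.*-zeroʳ (f (suc m))))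

sumFromTo-countSubsets-ω : ∀ n (Q : ℕ → Bool) →
  sumFromTo 1 n (λ k → + countSubsets k 1 (λ l → Q (length l)) * ω (+ n - + k))
  ≡ sumFromTo 1 n (λ m → + countCoprime Q m * W m (n ∸ m))
sumFromTo-countSubsets-ω n Q =
  trans (sumBelow-cong n (λ k k<n → cong (_* ω (+ n - + suc k)) (countSubsets≡divisorSum n (suc k) Q (s≤s z≤n) k<n)))
        (sumBelow-divisorSum-ω n (λ m → + countCoprime Q m))

mainTheorem17 : (n r : ℕ) → 1 ≤ n → 1 ≤ r →
    (sumFromTo 1 n (λ k → (+ (2 ^ k ∸ 1)) * ω (+ n - + k))
      ≡ sumFromTo 1 n (λ m → + Φ m * W m (n ∸ m)))
    × (sumFromTo 1 n (λ k → + (k C r) * ω (+ n - + k))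
      ≡ sumFromTo 1 n (λ m → + Φ[ r ] m * W m (n ∸ m)))
-- For n = 0 both sides are empty sums.
mainTheorem17 n r _ 1≤r =
  bySize (λ k → 2 ^ k ∸ 1) (λ x → does (1 ≤? x)) Φ (λ k → countSubsets-nonempty k 1) Φ≡countCoprime ,
  bySize (_C r) (λ x → does (x ≟ r)) Φ[ r ] (λ k → countSubsets-size k 1 r) (λ m → Φ[r]≡countCoprime r m 1≤r)
  where
  bySize : ∀ (a : ℕ → ℕ) (Q : ℕ → Bool) (φ : ℕ → ℕ) → (∀ k → countSubsets k 1 (λ l → Q (length l)) ≡ a k) →
           (∀ m → φ m ≡ countCoprime Q m) →
           sumFromTo 1 n (λ k → + a k * ω (+ n - + k)) ≡ sumFromTo 1 n (λ m → + φ m * W m (n ∸ m))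
  bySize a Q φ count≡a φ≡count = begin
    sumFromTo 1 n (λ k → + a k * ω (+ n - + k))
      ≡⟨ sumBelow-cong n (λ k _ → cong (λ x → + x * ω (+ n - + suc k)) (count≡a (suc k))) ⟨
    sumFromTo 1 n (λ k → + countSubsets k 1 (λ l → Q (length l)) * ω (+ n - + k))
      ≡⟨ sumFromTo-countSubsets-ω n Q ⟩
    sumFromTo 1 n (λ m → + countCoprime Q m * W m (n ∸ m))
      ≡⟨ sumBelow-cong n (λ m _ → cong (λ x → + x * W (suc m) (n ∸ suc m)) (φ≡count (suc m))) ⟨
    sumFromTo 1 n (λ m → + φ m * W m (n ∸ m))
      ∎
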